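{- Let $G$ be an $(s,k)$-edge-connected graph such that $k\geq 2$ and $\deg(s)\geq 4$. For any three distinct maximal independent sets $I_1,I_2,I_3$ of $L(G,s,k)$, each of size at least $2$, the corresponding dangerous sets $A_1,A_2,A_3$ satisfy $A_1\cap A_2\cap A_3=\emptyset$. In particular, if $I_1,I_2,I_3$ form a cycle in $I(L(G,s,k))$, then for $\{i,j,l\}=\{1,2,3\}$, $A_i\cap(A_j\cup A_l)$ is the union of $A_i\cap(A_j\setminus A_l)$ and $A_i\cap(A_l\setminus A_j)$.
   Context: All graphs are finite loopless multigraphs. $\delta(X)$ is the set of edges with exactly one end in $X$. A graph $G$ is $(s,k)$-edge-connected if $G$ has at least three vertices, $s\in V(G)$, $k$ is a positive integer, and any two vertices of $G$ different from $s$ are joined by $k$ pairwise edge-disjoint paths in $G$ (which may pass through $s$). Lifting edges $sv,sw$ means deleting them and adding $vw$ if $v\ne w$, only deleting them if $v=w$; result $G_{v,w}$. $sv,sw$ are $k$-liftable if $G_{v,w}$ is $(s,k)$-edge-connected. $L(G,s,k)$ has vertex set the edges at $s$, adjacent iff $k$-liftable. A set $A\subseteq V(G)\setminus\{s\}$ is dangerous if $A\ne\emptyset$, $V(G)\setminus(A\cup\{s\})\neq\emptyset$ and $|\delta(A)|\le k+1$. For an independent set $F$ of $L(G,s,k)$ with $|F|\ge 2$ and $F\ne V(L(G,s,k))$, the dangerous set corresponding to $F$ is the unique inclusion-minimal dangerous set containing the end other than $s$ of every edge of $F$. The independence graph $I(H)$ has as vertices the maximal independent sets of $H$, two adjacent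 iff they intersect. -}

module Defs where

open import Data.Nat using (ℕ; zero; suc; _≤_; _+_)
open import Data.Fin using (Fin; _≟_)
open import Data.Fin.Subset as S using (Subset; _∈_; _∉_; Nonempty; ∁; _∪_; ⁅_⁆)
open import Data.Fin.Subset.Properties using (_∈?_)
open import Data.Bool using (Bool; true; false; _xor_; not; T; T?)
open import Data.List using (List; []; _∷_; length; lookup; map; filter; _++_; allFin)
open import Data.List.Relation.Unary.All using (All)
open import Data.List.Relation.Unary.Unique.Propositional using (Unique)
open import Data.List.Relation.Binary.Disjoint.Propositional using (Disjoint)
open import Data.Product using (Σ; _×_; _,_; proj₁; proj₂; ∃-syntax)
open import Data.Sum using (_⊎_)
open import Relation.Nullary using (¬_; Dec; yes; no; ¬?)
open import Relation.Nullary.Decidable using (_×-dec_; _⊎-dec_; does)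
open import Relation.Binary.PropositionalEquality using (_≡_; _≢_)

-- A finite loopless multigraph on vertex set Fin n is given by its list of
-- edges; each edge is a pair of end vertices.  Edges are identified by their
-- position in the list (so parallel edges are distinct edges).
Graph : ℕ → Set
Graph n = List (Fin n × Fin n)

Loopless : ∀ {n} → Graph n → Set
Loopless G = All (λ p → proj₁ p ≢ proj₂ p) G

Edge : ∀ {n} → Graph n → Set
Edge G = Fin (length G)

ends : ∀ {n} (G : Graph n) → Edge G → Fin n × Fin n
ends G e = lookup G e

Joins : ∀ {n} (G : Graph n) → Edge G → Fin n → Fin n → Set
Joins G e u w = (ends G e ≡ (u , w)) ⊎ (ends G e ≡ (w , u))

data Walk {n} (G : Graph n) : Fin n → Fin n → List (Edge G) → List (Fin n) → Set where
  here : ∀ {u} → Walk G u u [] (u ∷ [])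
  step : ∀ {u w v e es vs} → Joins G e u w → Walk G w v es vs → Walk G u v (e ∷ es) (u ∷ vs)

IsPath : ∀ {n} (G : Graph n) → Fin n → Fin n → List (Edge G) → Set
IsPath G u v es = Σ (List _) λ vs → Walk G u v es vs × Unique vs

EdgeDisjointPaths : ∀ {n} (G : Graph n) → ℕ → Fin n → Fin n → Set
EdgeDisjointPaths G k u v =
  Σ (Fin k → List (Edge G)) λ P →
    (∀ i → IsPath G u v (P i)) × (∀ i j → i ≢ j → Disjoint (P i) (P j))

SKConnected : ∀ {n} (G : Graph n) → Fin n → ℕ → Set
SKConnected {n} G s k =
  (3 ≤ n) × (1 ≤ k) ×
  (∀ u v → u ≢ s → v ≢ s → u ≢ v → EdgeDisjointPaths G k u v)

AtS : ∀ {n} (G : Graph n) → Fin n → Edge G → Set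
AtS G s e = (proj₁ (ends G e) ≡ s) ⊎ (proj₂ (ends G e) ≡ s)

AtS? : ∀ {n} (G : Graph n) (s : Fin n) (e : Edge G) → Dec (AtS G s e)
AtS? G s e = (proj₁ (ends G e) ≟ s) ⊎-dec (proj₂ (ends G e) ≟ s)

deg : ∀ {n} (G : Graph n) → Fin n → ℕ
deg G s = length (filter (AtS? G s) (allFin (length G)))

-- the end of e other than s (meaningful when e is incident with s)
otherEnd : ∀ {n} (G : Graph n) → Fin n → Edge G → Fin n
otherEnd G s e with proj₁ (ends G e) ≟ s
... | yes _ = proj₂ (ends G e)
... | no _ = proj₁ (ends G e)

newEdge : ∀ {n} (v w : Fin n) → Dec (v ≡ w) → Graph n
newEdge v w (yes _) = []
newEdge v w (no _) = (v , w) ∷ []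

lift : ∀ {n} (G : Graph n) → Fin n → Edge G → Edge G → Graph n
lift G s e₁ e₂ =
  map (ends G) (filter (λ i → ¬? (i ≟ e₁) ×-dec ¬? (i ≟ e₂)) (allFin (length G)))
  ++ newEdge v w (v ≟ w)
  where
  v = otherEnd G s e₁
  w = otherEnd G s e₂

-- adjacency in L(G,s,k): distinct edges at s that are k-liftable
LAdj : ∀ {n} (G : Graph n) → Fin n → ℕ → Edge G → Edge G → Set
LAdj G s k e₁ e₂ = e₁ ≢ e₂ × AtS G s e₁ × AtS G s e₂ × SKConnected (lift G s e₁ e₂) s k

Independent : ∀ {n} (G : Graph n) → Fin n → ℕ → Subset (length G) → Set
Independent G s k F =
  (∀ e → e ∈ F → AtS G s e) × (∀ e f → e ∈ F → f ∈ F → ¬ LAdj G s k e f)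

MaximalIndependent : ∀ {n} (G : Graph n) → Fin n → ℕ → Subset (length G) → Set
MaximalIndependent G s k F =
  Independent G s k F ×
  (∀ F′ → Independent G s k F′ → F S.⊆ F′ → F′ S.⊆ F)

cutSize : ∀ {n} (G : Graph n) → Subset n → ℕ
cutSize G A = length (filter (λ e → T? (does (proj₁ (ends G e) ∈? A) xor does (proj₂ (ends G e) ∈? A)))
                             (allFin (length G)))

Dangerous : ∀ {n} (G : Graph n) → Fin n → ℕ → Subset n → Set
Dangerous G s k A =
  (s ∉ A) × Nonempty A × Nonempty (∁ (A ∪ ⁅ s ⁆)) × (cutSize G A ≤ suc k)

CorrespondingDangerous : ∀ {n} (G : Graph n) → Fin n → ℕ → Subset (length G) → Subset n → Set
CorrespondingDangerous G s k F A =
  Dangerous G s k A × (∀ e → e ∈ F → otherEnd G s e ∈ A) ×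
  (∀ B → Dangerous G s k B → (∀ e → e ∈ F → otherEnd G s e ∈ B) → B S.⊆ A → A S.⊆ B)

{-# OPTIONS --safe #-}
module Submission where

-- Suppose x ∈ A₁ ∩ A₂ ∩ A₃. For each pair Aᵢ, Aⱼ some edge at s ends in Aᵢ ∩ Aⱼ, for otherwise
-- Aᵢ ─ Aⱼ or Aⱼ ─ Aᵢ would be a dangerous set below Aᵢ or Aⱼ containing the ends of Iᵢ or Iⱼ. There
-- is at most one such edge, since two of them would give d(Aᵢ ─ Aⱼ) + d(Aⱼ ─ Aᵢ) + 4 ≤ d(Aᵢ) + d(Aⱼ),
-- i.e. 2k + 4 ≤ 2k + 2. So if an edge e at s ends in Aⱼ ∩ Aₗ, some edge of Iᵢ ends outside Aⱼ ∪ Aₗ: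
-- otherwise e is non-liftable with all of Iᵢ, hence in Iᵢ, next to a second edge of Iᵢ ending in Aⱼ or Aₗ.
-- Hence A₁ ─ A₂ ─ A₃, A₂ ─ A₁ ─ A₃, A₃ ─ A₁ ─ A₂ and A₁ ∩ A₂ ∩ A₃ all separate two vertices other
-- than s and have cuts of size at least k, while counting edge by edge, with an edge from s into
-- A₁ ∩ A₂ counted twice, their cuts sum to at most d(A₁) + d(A₂) + d(A₃) − 2 ≤ 3k + 1, so k ≤ 1.

open import Defs
open import Data.Bool using (Bool; true; false; _∧_; _∨_; not; _xor_)
open import Data.Bool.Properties using (T-≡)
open import Data.Empty using (⊥-elim)
open import Data.Fin using (Fin; zero; suc; _≟_)
open import Data.Fin.Properties using (any?; injective⇒≤)
open import Data.Fin.Subset using (Subset; _∈_; _∉_; _⊆_; Nonempty; Empty; ∁; _∪_; _∩_; _─_; ⁅_⁆; ∣_∣; ⊥)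
open import Data.Fin.Subset.Properties
  using (_∈?_; nonempty?; Empty-unique; ∣⊥∣≡0; ∣⁅x⁆∣≡1; p⊆q⇒∣p∣≤∣q∣; ⊆-antisym;
         x∈⁅x⁆; x∈⁅y⁆⇒x≡y; x∈p∪q⁺; x∈p∪q⁻; p⊆p∪q; q⊆p∪q; x∈p∩q⁺; x∈p∩q⁻; p∩q⊆p; p∩q⊆q;
         x∈p∧x∉q⇒x∈p─q; p─q⊆p; x∈∁p⇒x∉p; x∉p⇒x∈∁p)
open import Data.List using (List; []; _∷_; length; lookup; map; filter; allFin; tabulate; _++_)
open import Data.Vec using () renaming (_∷_ to _∷ᵥ_; here to hereᵥ; there to thereᵥ)
open import Data.List.Membership.Propositional using () renaming (_∈_ to _∈ₗ_)
open import Data.List.Membership.Propositional.Properties using (∈-filter⁺; ∈-allFin)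
open import Data.List.Properties using (map-∘; map-tabulate; tabulate-lookup; map-++)
open import Data.List.Relation.Unary.Any using (here; there; index)
open import Data.List.Relation.Unary.Any.Properties using (lookup-index)
open import Data.Nat using (ℕ; suc; _+_; _*_; _≤_; _≰_; _<_; _≤?_; z≤n; s≤s)
open import Data.Nat.ListAction using (sum)
open import Data.Nat.ListAction.Properties using (sum-++)
open import Data.Nat.Properties
  using (+-commutativeSemigroup; +-identityʳ; +-mono-≤; +-monoʳ-≤; +-monoˡ-≤; +-mono-<; +-comm; +-assoc; *-zeroʳ;
         *-distribˡ-+; *-monoʳ-≤; +-cancelˡ-≤; m≤m+n; m≤n+m; ≤-trans; ≤-reflexive; ≰⇒>; <⇒≱; 1+n≰n; module ≤-Reasoning)
open import Data.Nat.Tactic.RingSolver using (solve-∀)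
open import Algebra.Properties.CommutativeSemigroup +-commutativeSemigroup using (interchange; x∙yz≈y∙xz)
open import Data.Product using (_×_; _,_; proj₁; proj₂; ∃-syntax)
open import Data.Sum using (_⊎_; inj₁; inj₂; [_,_]; [_,_]′)
import Data.Sum as Sum
open import Function using (_∘_; id; case_of_)
open import Function.Bundles using (Equivalence)
open import Function.Definitions using (Injective)
open import Relation.Nullary using (¬_; Dec; yes; no; does; ¬?)
open import Relation.Nullary.Decidable using (True; toWitness; _×-dec_; dec-true; dec-false)
open import Relation.Unary using (Decidable)
open import Relation.Binary.PropositionalEquality using (_≡_; _≢_; refl; sym; trans; cong; cong₂; subst; subst₂; module ≡-Reasoning)

𝟙 : Bool → ℕ
𝟙 true = 1
𝟙 false = 0

module _ {a} {A : Set a} where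

  length-filter≡sum : ∀ {p} {P : A → Set p} (P? : Decidable P) (xs : List A) →
    length (filter P? xs) ≡ sum (map (𝟙 ∘ does ∘ P?) xs)
  length-filter≡sum P? [] = refl
  length-filter≡sum P? (x ∷ xs) with does (P? x)
  ... | true = cong suc (length-filter≡sum P? xs)
  ... | false = length-filter≡sum P? xs

  sum-map-mono : ∀ {f g : A → ℕ} → (∀ x → f x ≤ g x) → ∀ xs → sum (map f xs) ≤ sum (map g xs)
  sum-map-mono f≤g [] = z≤n
  sum-map-mono f≤g (x ∷ xs) = +-mono-≤ (f≤g x) (sum-map-mono f≤g xs)

  sum-map-+ : ∀ (f g : A → ℕ) xs → sum (map (λ x → f x + g x) xs) ≡ sum (map f xs) + sum (map g xs)
  sum-map-+ f g [] = refl
  sum-map-+ f g (x ∷ xs) =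
    trans (cong (f x + g x +_) (sum-map-+ f g xs)) (interchange (f x) (g x) _ _)

  sum-map-* : ∀ c (f : A → ℕ) xs → sum (map (λ x → c * f x) xs) ≡ c * sum (map f xs)
  sum-map-* c f [] = sym (*-zeroʳ c)
  sum-map-* c f (x ∷ xs) =
    trans (cong (c * f x +_) (sum-map-* c f xs)) (sym (*-distribˡ-+ c (f x) _))

  sum-map-filter : ∀ {p} {P : A → Set p} (P? : Decidable P) (f : A → ℕ) xs →
    sum (map f (filter P? xs)) + sum (map f (filter (¬? ∘ P?) xs)) ≡ sum (map f xs)
  sum-map-filter P? f [] = refl
  sum-map-filter P? f (x ∷ xs) with P? x
  ... | yes _ = trans (+-assoc (f x) _ _) (cong (f x +_) (sum-map-filter P? f xs))
  ... | no _ = trans (x∙yz≈y∙xz (sum (map f (filter P? xs))) (f x) _) (cong (f x +_) (sum-map-filter P? f xs))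

  sum-map-lookup : ∀ (f : A → ℕ) xs → sum (map (f ∘ lookup xs) (allFin (length xs))) ≡ sum (map f xs)
  sum-map-lookup f xs = cong sum (begin
    map (f ∘ lookup xs) (allFin (length xs))     ≡⟨ map-∘ (allFin (length xs)) ⟩
    map f (map (lookup xs) (allFin (length xs))) ≡⟨ cong (map f) (map-tabulate id (lookup xs)) ⟩
    map f (tabulate (lookup xs))                 ≡⟨ cong (map f) (tabulate-lookup xs) ⟩
    map f xs                                     ∎)
    where open ≡-Reasoning

  ∈⇒≤sum-map : ∀ (f : A → ℕ) {x xs} → x ∈ₗ xs → f x ≤ sum (map f xs)
  ∈⇒≤sum-map f (here refl) = m≤m+n _ _
  ∈⇒≤sum-map f {xs = y ∷ _} (there x∈xs) = ≤-trans (∈⇒≤sum-map f x∈xs) (m≤n+m _ (f y))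

  ∈-∈⇒+≤sum-map : ∀ (f : A → ℕ) {x y xs} → x ∈ₗ xs → y ∈ₗ xs → x ≢ y → f x + f y ≤ sum (map f xs)
  ∈-∈⇒+≤sum-map f (here refl) (here refl) x≢y = ⊥-elim (x≢y refl)
  ∈-∈⇒+≤sum-map f (here refl) (there y∈xs) _ = +-monoʳ-≤ (f _) (∈⇒≤sum-map f y∈xs)
  ∈-∈⇒+≤sum-map f {x} {y} {_ ∷ xs} (there x∈xs) (here refl) _ =
    subst (_≤ f y + sum (map f xs)) (+-comm (f y) (f x)) (+-monoʳ-≤ (f y) (∈⇒≤sum-map f x∈xs))
  ∈-∈⇒+≤sum-map f {xs = z ∷ _} (there x∈xs) (there y∈xs) x≢y =
    ≤-trans (∈-∈⇒+≤sum-map f x∈xs y∈xs x≢y) (m≤n+m _ (f z))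

  injective⇒≤length : ∀ {k} {xs : List A} (c : Fin k → A) → Injective _≡_ _≡_ c →
    (∀ i → c i ∈ₗ xs) → k ≤ length xs
  injective⇒≤length {xs = xs} c c-injective c∈xs = injective⇒≤ λ {i} {j} eq → c-injective (begin
    c i                        ≡⟨ lookup-index (c∈xs i) ⟩
    lookup xs (index (c∈xs i)) ≡⟨ cong (lookup xs) eq ⟩
    lookup xs (index (c∈xs j)) ≡⟨ lookup-index (c∈xs j) ⟨
    c j                        ∎)
    where open ≡-Reasoning

2k+4≰2k+2 : ∀ k → k + k + 2 * 2 ≰ suc k + suc k
2k+4≰2k+2 k le = case +-cancelˡ-≤ (k + k) 4 2 (subst (k + k + 4 ≤_) (2+2k≡2k+2 k) le) of λ { (s≤s (s≤s ())) }
  where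
  2+2k≡2k+2 : ∀ k → suc k + suc k ≡ k + k + 2
  2+2k≡2k+2 = solve-∀

4k+2≰3k+3 : ∀ k → 2 ≤ k → k + k + k + k + 2 * 1 ≰ suc k + suc k + suc k
4k+2≰3k+3 k 2≤k le = case ≤-trans (+-monoˡ-≤ 2 2≤k) (+-cancelˡ-≤ (k + k + k) (k + 2) 3 (subst₂ _≤_ (lhs k) (rhs k) le)) of
  λ { (s≤s (s≤s (s≤s ()))) }
  where
  lhs : ∀ k → k + k + k + k + 2 * 1 ≡ k + k + k + (k + 2)
  lhs = solve-∀
  rhs : ∀ k → suc k + suc k + suc k ≡ k + k + k + 3
  rhs = solve-∀

∀-Bool? : ∀ {p} {P : Bool → Set p} → (∀ b → Dec (P b)) → Dec (∀ b → P b)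
∀-Bool? P? with P? true | P? false
... | yes t | yes f = yes λ { true → t ; false → f }
... | no ¬t | _     = no λ h → ¬t (h true)
... | yes _ | no ¬f = no λ h → ¬f (h false)

by-truth-table₄ : {P : Bool → Bool → Bool → Bool → Set} (P? : ∀ a b c d → Dec (P a b c d)) →
  {True (∀-Bool? λ a → ∀-Bool? λ b → ∀-Bool? λ c → ∀-Bool? λ d → P? a b c d)} →
  ∀ a b c d → P a b c d
by-truth-table₄ P? {holds} = toWitness holds

by-truth-table₆ : {P : Bool → Bool → Bool → Bool → Bool → Bool → Set}
  (P? : ∀ a b c d e f → Dec (P a b c d e f)) →
  {True (∀-Bool? λ a → ∀-Bool? λ b → ∀-Bool? λ c → ∀-Bool? λ d → ∀-Bool? λ e → ∀-Bool? λ f → P? a b c d e f)} →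
  ∀ a b c d e f → P a b c d e f
by-truth-table₆ P? {holds} = toWitness holds

private variable n : ℕ

infix 4 _∈ᵇ_
_∈ᵇ_ : Fin n → Subset n → Bool
x ∈ᵇ X = does (x ∈? X)

∈ᵇ-∩ : ∀ x (p q : Subset n) → (x ∈ᵇ p ∩ q) ≡ (x ∈ᵇ p) ∧ (x ∈ᵇ q)
∈ᵇ-∩ zero (true ∷ᵥ p) (true ∷ᵥ q) = refl
∈ᵇ-∩ zero (true ∷ᵥ p) (false ∷ᵥ q) = refl
∈ᵇ-∩ zero (false ∷ᵥ p) (_ ∷ᵥ q) = refl
∈ᵇ-∩ (suc x) (_ ∷ᵥ p) (_ ∷ᵥ q) = ∈ᵇ-∩ x p q

∈ᵇ-─ : ∀ x (p q : Subset n) → (x ∈ᵇ p ─ q) ≡ (x ∈ᵇ p) ∧ not (x ∈ᵇ q)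
∈ᵇ-─ zero (true ∷ᵥ p) (true ∷ᵥ q) = refl
∈ᵇ-─ zero (true ∷ᵥ p) (false ∷ᵥ q) = refl
∈ᵇ-─ zero (false ∷ᵥ p) (true ∷ᵥ q) = refl
∈ᵇ-─ zero (false ∷ᵥ p) (false ∷ᵥ q) = refl
∈ᵇ-─ (suc x) (_ ∷ᵥ p) (_ ∷ᵥ q) = ∈ᵇ-─ x p q

x∈q⇒x∉p─q : ∀ {x} (p q : Subset n) → x ∈ q → x ∉ p ─ q
x∈q⇒x∉p─q (_ ∷ᵥ _) (_ ∷ᵥ _) hereᵥ ()
x∈q⇒x∉p─q (_ ∷ᵥ p) (_ ∷ᵥ q) (thereᵥ x∈q) (thereᵥ x∈p─q) = x∈q⇒x∉p─q p q x∈q x∈p─q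

x∈q⇒x∉p─q─r : ∀ {x} (p q r : Subset n) → x ∈ q → x ∉ p ─ q ─ r
x∈q⇒x∉p─q─r p q r x∈q = x∈q⇒x∉p─q p q x∈q ∘ p─q⊆p (p ─ q) r

p─q─r⊆p : ∀ (p q r : Subset n) → p ─ q ─ r ⊆ p
p─q─r⊆p p q r = p─q⊆p p q ∘ p─q⊆p (p ─ q) r

x∈p─q─r⇒x∉p∩q∩r : ∀ {x} (p q r : Subset n) → x ∈ p ─ q ─ r → x ∉ p ∩ q ∩ r
x∈p─q─r⇒x∉p∩q∩r p q r x∈p─q─r x∈p∩q∩r = x∈q⇒x∉p─q─r p q r (p∩q⊆p q r (p∩q⊆q p (q ∩ r) x∈p∩q∩r)) x∈p─q─r

∈-∉⇒≢ : ∀ {x y} {p : Subset n} → x ∈ p → y ∉ p → x ≢ y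
∈-∉⇒≢ x∈p y∉p refl = y∉p x∈p

∈∁∪⁅⁆⁻ : ∀ {x y} {p : Subset n} → x ∈ ∁ (p ∪ ⁅ y ⁆) → x ∉ p × x ≢ y
∈∁∪⁅⁆⁻ {y = y} {p} x∈ = x∈∁p⇒x∉p x∈ ∘ p⊆p∪q ⁅ y ⁆ ,
                        λ { refl → x∈∁p⇒x∉p x∈ (x∈p∪q⁺ (inj₂ (x∈⁅x⁆ y))) }

∈∁∪⁅⁆⁺ : ∀ {x y} {p : Subset n} → x ∉ p → x ≢ y → x ∈ ∁ (p ∪ ⁅ y ⁆)
∈∁∪⁅⁆⁺ {y = y} {p} x∉p x≢y = x∉p⇒x∈∁p λ x∈ → [ x∉p , x≢y ∘ x∈⁅y⁆⇒x≡y y ] (x∈p∪q⁻ p ⁅ y ⁆ x∈)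

1≤∣p∣⇒nonempty : ∀ {n} {p : Subset n} → 1 ≤ ∣ p ∣ → Nonempty p
1≤∣p∣⇒nonempty {n} {p} 1≤∣p∣ with nonempty? p
... | yes ne = ne
... | no empty = case ≤-trans 1≤∣p∣ (≤-reflexive (trans (cong ∣_∣ (Empty-unique empty)) (∣⊥∣≡0 n))) of λ ()

2≤∣p∣⇒another : ∀ {p : Subset n} → 2 ≤ ∣ p ∣ → ∀ x → ∃[ y ] y ∈ p × y ≢ x
2≤∣p∣⇒another {p = p} 2≤∣p∣ x with any? (λ y → y ∈? p ×-dec ¬? (y ≟ x))
... | yes another = another
... | no none = ⊥-elim (1+n≰n (≤-trans 2≤∣p∣ (≤-trans (p⊆q⇒∣p∣≤∣q∣ p⊆⁅x⁆) (≤-reflexive (∣⁅x⁆∣≡1 x)))))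
  where
  p⊆⁅x⁆ : p ⊆ ⁅ x ⁆
  p⊆⁅x⁆ {y} y∈p with y ≟ x
  ... | yes refl = x∈⁅x⁆ x
  ... | no y≢x = ⊥-elim (none (y , y∈p , y≢x))

∩-∪≡∩─∪∩─ : ∀ (X Y Z : Subset n) → (∀ {x} → ¬ (x ∈ X × x ∈ Y × x ∈ Z)) →
  X ∩ (Y ∪ Z) ≡ (X ∩ (Y ─ Z)) ∪ (X ∩ (Z ─ Y))
∩-∪≡∩─∪∩─ X Y Z disjoint = ⊆-antisym to from
  where
  to : X ∩ (Y ∪ Z) ⊆ (X ∩ (Y ─ Z)) ∪ (X ∩ (Z ─ Y))
  to x∈ with x∈p∩q⁻ X (Y ∪ Z) x∈
  ... | x∈X , x∈Y∪Z with x∈p∪q⁻ Y Z x∈Y∪Z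
  ... | inj₁ x∈Y = x∈p∪q⁺ (inj₁ (x∈p∩q⁺ (x∈X , x∈p∧x∉q⇒x∈p─q x∈Y λ x∈Z → disjoint (x∈X , x∈Y , x∈Z))))
  ... | inj₂ x∈Z = x∈p∪q⁺ (inj₂ (x∈p∩q⁺ (x∈X , x∈p∧x∉q⇒x∈p─q x∈Z λ x∈Y → disjoint (x∈X , x∈Y , x∈Z))))
  from : (X ∩ (Y ─ Z)) ∪ (X ∩ (Z ─ Y)) ⊆ X ∩ (Y ∪ Z)
  from x∈ with x∈p∪q⁻ (X ∩ (Y ─ Z)) (X ∩ (Z ─ Y)) x∈
  ... | inj₁ x∈′ = x∈p∩q⁺ (p∩q⊆p X _ x∈′ , p⊆p∪q Z (p─q⊆p Y Z (p∩q⊆q X _ x∈′)))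
  ... | inj₂ x∈′ = x∈p∩q⁺ (p∩q⊆p X _ x∈′ , q⊆p∪q Y Z (p─q⊆p Z Y (p∩q⊆q X _ x∈′)))

-- Cuts

crosses : Subset n → Fin n × Fin n → Bool
crosses X (p , q) = (p ∈ᵇ X) xor (q ∈ᵇ X)

separated⇒crosses : ∀ {X : Subset n} {u w} → u ∈ X → w ∉ X →
  crosses X (u , w) ≡ true × crosses X (w , u) ≡ true
separated⇒crosses {X = X} {u} {w} u∈X w∉X rewrite dec-true (u ∈? X) u∈X | dec-false (w ∈? X) w∉X = refl , refl

cutSize≡sum-edges : ∀ (H : Graph n) X → cutSize H X ≡ sum (map (𝟙 ∘ crosses X ∘ ends H) (allFin (length H)))
cutSize≡sum-edges H X = length-filter≡sum _ (allFin (length H))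

cutSize≡sum : ∀ (H : Graph n) X → cutSize H X ≡ sum (map (𝟙 ∘ crosses X) H)
cutSize≡sum H X = trans (cutSize≡sum-edges H X) (sum-map-lookup (𝟙 ∘ crosses X) H)

walk-crosses : ∀ {H : Graph n} {X u v es vs} → Walk H u v es vs → u ∈ X → v ∉ X →
  ∃[ e ] e ∈ₗ es × crosses X (ends H e) ≡ true
walk-crosses here u∈X u∉X = ⊥-elim (u∉X u∈X)
walk-crosses {H = H} {X = X} (step {u = u} {w = w} {e = e} joins walk) u∈X v∉X with w ∈? X
... | yes w∈X = let e′ , e′∈es , crosses = walk-crosses walk w∈X v∉X in e′ , there e′∈es , crosses
... | no w∉X = e , here refl , joins-crosses joins
  where
  joins-crosses : Joins H e u w → crosses X (ends H e) ≡ true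
  joins-crosses (inj₁ eq) = subst (λ pq → crosses X pq ≡ true) (sym eq) (proj₁ (separated⇒crosses u∈X w∉X))
  joins-crosses (inj₂ eq) = subst (λ pq → crosses X pq ≡ true) (sym eq) (proj₂ (separated⇒crosses u∈X w∉X))

k≤cutSize : ∀ {H : Graph n} {s k X u v} → SKConnected H s k →
  u ∈ X → v ∉ X → u ≢ s → v ≢ s → k ≤ cutSize H X
k≤cutSize {H = H} {k = k} {X} (_ , _ , connected) u∈X v∉X u≢s v≢s =
  injective⇒≤length crossingEdge crossingEdge-injective crossingEdge∈cut
  where
  paths = connected _ _ u≢s v≢s (∈-∉⇒≢ u∈X v∉X)
  path = proj₁ paths
  crossing : ∀ i → ∃[ e ] e ∈ₗ path i × crosses X (ends H e) ≡ true
  crossing i = walk-crosses (proj₁ (proj₂ (proj₁ (proj₂ paths) i))) u∈X v∉X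
  crossingEdge : Fin k → Edge H
  crossingEdge = proj₁ ∘ crossing
  crossingEdge-injective : Injective _≡_ _≡_ crossingEdge
  crossingEdge-injective {i} {j} eq with i ≟ j
  ... | yes i≡j = i≡j
  ... | no i≢j = ⊥-elim (proj₂ (proj₂ paths) i j i≢j
                   (proj₁ (proj₂ (crossing i)) , subst (_∈ₗ path j) (sym eq) (proj₁ (proj₂ (crossing j)))))
  crossingEdge∈cut : ∀ i → crossingEdge i ∈ₗ filter _ (allFin (length H))
  crossingEdge∈cut i = ∈-filter⁺ _ (∈-allFin _) (Equivalence.from T-≡ (proj₂ (proj₂ (crossing i))))

twoOf : Bool → Bool → Bool → Bool
twoOf a b c = (a ∧ b) ∨ (a ∧ c) ∨ (b ∧ c)

jump₂ : Bool → Bool → Bool → Bool → Bool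
jump₂ a b a′ b′ = (not (a ∨ b) ∧ a′ ∧ b′) ∨ (not (a′ ∨ b′) ∧ a ∧ b)

jump₃ : Bool → Bool → Bool → Bool → Bool → Bool → Bool
jump₃ a b c a′ b′ c′ = (not (a ∨ b ∨ c) ∧ twoOf a′ b′ c′) ∨ (not (a′ ∨ b′ ∨ c′) ∧ twoOf a b c)

jumps₂ : Subset n → Subset n → Fin n × Fin n → Bool
jumps₂ A B (p , q) = jump₂ (p ∈ᵇ A) (p ∈ᵇ B) (q ∈ᵇ A) (q ∈ᵇ B)

jumps₃ : Subset n → Subset n → Subset n → Fin n × Fin n → Bool
jumps₃ A B C (p , q) = jump₃ (p ∈ᵇ A) (p ∈ᵇ B) (p ∈ᵇ C) (q ∈ᵇ A) (q ∈ᵇ B) (q ∈ᵇ C)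

-- An edge from outside A ∪ B into A ∩ B crosses A and B but neither A ─ B nor B ─ A.
crosses-─-─ᵇ : ∀ a b a′ b′ →
  𝟙 ((a ∧ not b) xor (a′ ∧ not b′)) + 𝟙 ((b ∧ not a) xor (b′ ∧ not a′)) + 2 * 𝟙 (jump₂ a b a′ b′)
  ≤ 𝟙 (a xor a′) + 𝟙 (b xor b′)
crosses-─-─ᵇ = by-truth-table₄ λ _ _ _ _ → _ ≤? _

-- An edge from outside A ∪ B ∪ C into at least two of the sets has two crossings to spare.
crosses-─-─-─-∩ᵇ : ∀ a b c a′ b′ c′ →
  𝟙 ((a ∧ not b) ∧ not c xor (a′ ∧ not b′) ∧ not c′) + 𝟙 ((b ∧ not a) ∧ not c xor (b′ ∧ not a′) ∧ not c′) +
  𝟙 ((c ∧ not a) ∧ not b xor (c′ ∧ not a′) ∧ not b′) + 𝟙 (a ∧ b ∧ c xor a′ ∧ b′ ∧ c′) +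
  2 * 𝟙 (jump₃ a b c a′ b′ c′)
  ≤ 𝟙 (a xor a′) + 𝟙 (b xor b′) + 𝟙 (c xor c′)
crosses-─-─-─-∩ᵇ = by-truth-table₆ λ _ _ _ _ _ _ → _ ≤? _

crosses-─-─ : ∀ (A B : Subset n) pq →
  𝟙 (crosses (A ─ B) pq) + 𝟙 (crosses (B ─ A) pq) + 2 * 𝟙 (jumps₂ A B pq) ≤ 𝟙 (crosses A pq) + 𝟙 (crosses B pq)
crosses-─-─ A B (p , q) rewrite ∈ᵇ-─ p A B | ∈ᵇ-─ q A B | ∈ᵇ-─ p B A | ∈ᵇ-─ q B A =
  crosses-─-─ᵇ (p ∈ᵇ A) (p ∈ᵇ B) (q ∈ᵇ A) (q ∈ᵇ B)

crosses-─-─-─-∩ : ∀ (A B C : Subset n) pq →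
  𝟙 (crosses (A ─ B ─ C) pq) + 𝟙 (crosses (B ─ A ─ C) pq) + 𝟙 (crosses (C ─ A ─ B) pq) +
  𝟙 (crosses (A ∩ B ∩ C) pq) + 2 * 𝟙 (jumps₃ A B C pq)
  ≤ 𝟙 (crosses A pq) + 𝟙 (crosses B pq) + 𝟙 (crosses C pq)
crosses-─-─-─-∩ A B C (p , q)
  rewrite ∈ᵇ-─ p (A ─ B) C | ∈ᵇ-─ q (A ─ B) C | ∈ᵇ-─ p A B | ∈ᵇ-─ q A B
        | ∈ᵇ-─ p (B ─ A) C | ∈ᵇ-─ q (B ─ A) C | ∈ᵇ-─ p B A | ∈ᵇ-─ q B A
        | ∈ᵇ-─ p (C ─ A) B | ∈ᵇ-─ q (C ─ A) B | ∈ᵇ-─ p C A | ∈ᵇ-─ q C A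
        | ∈ᵇ-∩ p A (B ∩ C) | ∈ᵇ-∩ q A (B ∩ C) | ∈ᵇ-∩ p B C | ∈ᵇ-∩ q B C =
  crosses-─-─-─-∩ᵇ (p ∈ᵇ A) (p ∈ᵇ B) (p ∈ᵇ C) (q ∈ᵇ A) (q ∈ᵇ B) (q ∈ᵇ C)

cutSize-─-─ : ∀ (G : Graph n) A B →
  cutSize G (A ─ B) + cutSize G (B ─ A) + 2 * sum (map (𝟙 ∘ jumps₂ A B) G) ≤ cutSize G A + cutSize G B
cutSize-─-─ G A B = begin
  cutSize G (A ─ B) + cutSize G (B ─ A) + 2 * Σ J
    ≡⟨ cong₂ (λ x y → x + y + 2 * Σ J) (cutSize≡sum G (A ─ B)) (cutSize≡sum G (B ─ A)) ⟩
  Σ (χ (A ─ B)) + Σ (χ (B ─ A)) + 2 * Σ J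
    ≡⟨ trans (sum-map-+ _ _ G) (cong₂ _+_ (sum-map-+ (χ (A ─ B)) (χ (B ─ A)) G) (sum-map-* 2 J G)) ⟨
  Σ (λ pq → χ (A ─ B) pq + χ (B ─ A) pq + 2 * J pq)
    ≤⟨ sum-map-mono (crosses-─-─ A B) G ⟩
  Σ (λ pq → χ A pq + χ B pq)
    ≡⟨ sum-map-+ (χ A) (χ B) G ⟩
  Σ (χ A) + Σ (χ B)
    ≡⟨ cong₂ _+_ (cutSize≡sum G A) (cutSize≡sum G B) ⟨
  cutSize G A + cutSize G B ∎
  where
  open ≤-Reasoning
  Σ : (Fin _ × Fin _ → ℕ) → ℕ
  Σ f = sum (map f G)
  χ : Subset _ → Fin _ × Fin _ → ℕ
  χ X = 𝟙 ∘ crosses X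
  J = 𝟙 ∘ jumps₂ A B

cutSize-─-─-─-∩ : ∀ (G : Graph n) A B C →
  cutSize G (A ─ B ─ C) + cutSize G (B ─ A ─ C) + cutSize G (C ─ A ─ B) + cutSize G (A ∩ B ∩ C) +
  2 * sum (map (𝟙 ∘ jumps₃ A B C) G)
  ≤ cutSize G A + cutSize G B + cutSize G C
cutSize-─-─-─-∩ G A B C = begin
  cutSize G (A ─ B ─ C) + cutSize G (B ─ A ─ C) + cutSize G (C ─ A ─ B) + cutSize G (A ∩ B ∩ C) + 2 * Σ J
    ≡⟨ cong (_+ 2 * Σ J) (cong₂ _+_ (cong₂ _+_ (cong₂ _+_ (cutSize≡sum G (A ─ B ─ C)) (cutSize≡sum G (B ─ A ─ C)))
                                              (cutSize≡sum G (C ─ A ─ B)))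
                                   (cutSize≡sum G (A ∩ B ∩ C))) ⟩
  Σ χ₁ + Σ χ₂ + Σ χ₃ + Σ χ₄ + 2 * Σ J
    ≡⟨ trans (sum-map-+ _ _ G) (cong₂ _+_ (trans (sum-map-+ _ _ G) (cong (_+ Σ χ₄)
            (trans (sum-map-+ _ _ G) (cong (_+ Σ χ₃) (sum-map-+ χ₁ χ₂ G))))) (sum-map-* 2 J G)) ⟨
  Σ (λ pq → χ₁ pq + χ₂ pq + χ₃ pq + χ₄ pq + 2 * J pq)
    ≤⟨ sum-map-mono (crosses-─-─-─-∩ A B C) G ⟩
  Σ (λ pq → χ A pq + χ B pq + χ C pq)
    ≡⟨ trans (sum-map-+ _ _ G) (cong (_+ Σ (χ C)) (sum-map-+ (χ A) (χ B) G)) ⟩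
  Σ (χ A) + Σ (χ B) + Σ (χ C)
    ≡⟨ cong₂ _+_ (cong₂ _+_ (cutSize≡sum G A) (cutSize≡sum G B)) (cutSize≡sum G C) ⟨
  cutSize G A + cutSize G B + cutSize G C ∎
  where
  open ≤-Reasoning
  Σ : (Fin _ × Fin _ → ℕ) → ℕ
  Σ f = sum (map f G)
  χ : Subset _ → Fin _ × Fin _ → ℕ
  χ X = 𝟙 ∘ crosses X
  χ₁ = χ (A ─ B ─ C)
  χ₂ = χ (B ─ A ─ C)
  χ₃ = χ (C ─ A ─ B)
  χ₄ = χ (A ∩ B ∩ C)
  J = 𝟙 ∘ jumps₃ A B C

ends≤sum : ∀ (G : Graph n) (w : Fin n × Fin n → ℕ) e → w (ends G e) ≤ sum (map w G)
ends≤sum G w e = subst (w (ends G e) ≤_) (sum-map-lookup w G) (∈⇒≤sum-map (w ∘ ends G) (∈-allFin e))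

ends+ends≤sum : ∀ (G : Graph n) (w : Fin n × Fin n → ℕ) {e f} → e ≢ f →
  w (ends G e) + w (ends G f) ≤ sum (map w G)
ends+ends≤sum G w {e} {f} e≢f =
  subst (w (ends G e) + w (ends G f) ≤_) (sum-map-lookup w G) (∈-∈⇒+≤sum-map (w ∘ ends G) (∈-allFin e) (∈-allFin f) e≢f)

-- Edges at s and lifting

ends-atS : ∀ {G : Graph n} {s e} → AtS G s e →
  ends G e ≡ (s , otherEnd G s e) ⊎ ends G e ≡ (otherEnd G s e , s)
ends-atS {G = G} {s} {e} at with proj₁ (ends G e) ≟ s
... | yes first≡s = inj₁ (cong (_, proj₂ (ends G e)) first≡s)
ends-atS (inj₁ first≡s) | no first≢s = ⊥-elim (first≢s first≡s)
ends-atS {G = G} {e = e} (inj₂ second≡s) | no _ = inj₂ (cong (proj₁ (ends G e) ,_) second≡s)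

atS-elim : ∀ {G : Graph n} {s e} (P : Fin n × Fin n → Set) → AtS G s e →
  P (s , otherEnd G s e) → P (otherEnd G s e , s) → P (ends G e)
atS-elim {G = G} P at P-out P-in =
  [ (λ eq → subst P (sym eq) P-out) , (λ eq → subst P (sym eq) P-in) ] (ends-atS {G = G} at)

atS-crosses : ∀ {G : Graph n} {s e X} → AtS G s e → s ∉ X → otherEnd G s e ∈ X →
  crosses X (ends G e) ≡ true
atS-crosses {G = G} {X = X} at s∉X v∈X =
  atS-elim {G = G} (λ pq → crosses X pq ≡ true) at (proj₂ (separated⇒crosses v∈X s∉X)) (proj₁ (separated⇒crosses v∈X s∉X))

atS-jumps₂ : ∀ {G : Graph n} {s e A B} → AtS G s e → s ∉ A → s ∉ B → otherEnd G s e ∈ A ∩ B →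
  jumps₂ A B (ends G e) ≡ true
atS-jumps₂ {G = G} {s} {e} {A} {B} at s∉A s∉B v∈A∩B = atS-elim {G = G} (λ pq → jumps₂ A B pq ≡ true) at (proj₁ both) (proj₂ both)
  where
  v = otherEnd G s e
  both : jumps₂ A B (s , v) ≡ true × jumps₂ A B (v , s) ≡ true
  both rewrite dec-false (s ∈? A) s∉A | dec-false (s ∈? B) s∉B
             | dec-true (v ∈? A) (proj₁ (x∈p∩q⁻ A B v∈A∩B)) | dec-true (v ∈? B) (proj₂ (x∈p∩q⁻ A B v∈A∩B)) = refl , refl

atS-jumps₃ : ∀ {G : Graph n} {s e A B C} → AtS G s e → s ∉ A → s ∉ B → s ∉ C → otherEnd G s e ∈ A ∩ B →
  jumps₃ A B C (ends G e) ≡ true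
atS-jumps₃ {G = G} {s} {e} {A} {B} {C} at s∉A s∉B s∉C v∈A∩B =
  atS-elim {G = G} (λ pq → jumps₃ A B C pq ≡ true) at (proj₁ both) (proj₂ both)
  where
  v = otherEnd G s e
  both : jumps₃ A B C (s , v) ≡ true × jumps₃ A B C (v , s) ≡ true
  both rewrite dec-false (s ∈? A) s∉A | dec-false (s ∈? B) s∉B | dec-false (s ∈? C) s∉C
             | dec-true (v ∈? A) (proj₁ (x∈p∩q⁻ A B v∈A∩B)) | dec-true (v ∈? B) (proj₂ (x∈p∩q⁻ A B v∈A∩B)) = refl , refl

newEdge-inside : ∀ {X : Subset n} {v w} (v≟w : Dec (v ≡ w)) → v ∈ X → w ∈ X →
  sum (map (𝟙 ∘ crosses X) (newEdge v w v≟w)) ≡ 0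
newEdge-inside (yes _) _ _ = refl
newEdge-inside {X = X} {v} {w} (no _) v∈X w∈X rewrite dec-true (v ∈? X) v∈X | dec-true (w ∈? X) w∈X = refl

cutSize-lift≡ : ∀ {G : Graph n} {s X e f} → otherEnd G s e ∈ X → otherEnd G s f ∈ X →
  cutSize (lift G s e f) X ≡
  sum (map (𝟙 ∘ crosses X ∘ ends G) (filter (λ i → ¬? (i ≟ e) ×-dec ¬? (i ≟ f)) (allFin (length G))))
cutSize-lift≡ {G = G} {s} {X} {e} {f} v∈X w∈X = begin
  cutSize (lift G s e f) X
    ≡⟨ cutSize≡sum (lift G s e f) X ⟩
  sum (map χ (map (ends G) kept ++ newEdge v w (v ≟ w)))
    ≡⟨ cong sum (map-++ χ (map (ends G) kept) _) ⟩
  sum (map χ (map (ends G) kept) ++ map χ (newEdge v w (v ≟ w)))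
    ≡⟨ sum-++ (map χ (map (ends G) kept)) _ ⟩
  sum (map χ (map (ends G) kept)) + sum (map χ (newEdge v w (v ≟ w)))
    ≡⟨ cong₂ _+_ (sym (cong sum (map-∘ kept))) (newEdge-inside (v ≟ w) v∈X w∈X) ⟩
  sum (map (χ ∘ ends G) kept) + 0
    ≡⟨ +-identityʳ _ ⟩
  sum (map (χ ∘ ends G) kept) ∎
  where
  open ≡-Reasoning
  χ = 𝟙 ∘ crosses X
  v = otherEnd G s e
  w = otherEnd G s f
  kept = filter (λ i → ¬? (i ≟ e) ×-dec ¬? (i ≟ f)) (allFin (length G))

cutSize-lift : ∀ {G : Graph n} {s X e f} → e ≢ f → AtS G s e → AtS G s f → s ∉ X →
  otherEnd G s e ∈ X → otherEnd G s f ∈ X → cutSize (lift G s e f) X + 2 ≤ cutSize G X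
cutSize-lift {G = G} {s} {X} {e} {f} e≢f ate atf s∉X v∈X w∈X = begin
  cutSize (lift G s e f) X + 2
    ≡⟨ cong (_+ 2) (cutSize-lift≡ {G = G} {s} {X} {e} {f} v∈X w∈X) ⟩
  Σ kept + 2
    ≡⟨ cong (λ b → Σ kept + (𝟙 b + 𝟙 b)) (atS-crosses {G = G} ate s∉X v∈X) ⟨
  Σ kept + (χ e + χ e)
    ≡⟨ cong (λ b → Σ kept + (χ e + 𝟙 b)) (trans (atS-crosses {G = G} ate s∉X v∈X) (sym (atS-crosses {G = G} atf s∉X w∈X))) ⟩
  Σ kept + (χ e + χ f)
    ≤⟨ +-monoʳ-≤ (Σ kept) (∈-∈⇒+≤sum-map χ (removed e λ (e≢e , _) → e≢e refl) (removed f λ (_ , f≢f) → f≢f refl) e≢f) ⟩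
  Σ kept + Σ (filter (¬? ∘ keep?) (allFin (length G)))
    ≡⟨ sum-map-filter keep? χ (allFin (length G)) ⟩
  Σ (allFin (length G))
    ≡⟨ cutSize≡sum-edges G X ⟨
  cutSize G X ∎
  where
  open ≤-Reasoning
  χ = 𝟙 ∘ crosses X ∘ ends G
  keep? = λ i → ¬? (i ≟ e) ×-dec ¬? (i ≟ f)
  kept = filter keep? (allFin (length G))
  Σ = λ is → sum (map χ is)
  removed : ∀ i → ¬ (i ≢ e × i ≢ f) → i ∈ₗ filter (¬? ∘ keep?) (allFin (length G))
  removed i kept-i = ∈-filter⁺ (¬? ∘ keep?) (∈-allFin i) kept-i

dangerous⇒¬LAdj : ∀ {G : Graph n} {s k X e f} → Dangerous G s k X →
  otherEnd G s e ∈ X → otherEnd G s f ∈ X → ¬ LAdj G s k e f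
dangerous⇒¬LAdj {G = G} {s} {k} {X} {e} {f} (s∉X , _ , (y , y∈outside) , cut≤) v∈X w∈X (e≢f , ate , atf , liftable) =
  1+n≰n (begin
    suc (suc k)                   ≡⟨ +-comm 2 k ⟩
    k + 2                         ≤⟨ +-monoˡ-≤ 2 (k≤cutSize liftable v∈X y∉X (∈-∉⇒≢ v∈X s∉X) y≢s) ⟩
    cutSize (lift G s e f) X + 2  ≤⟨ cutSize-lift {G = G} e≢f ate atf s∉X v∈X w∈X ⟩
    cutSize G X                   ≤⟨ cut≤ ⟩
    suc k                         ∎)
  where
  open ≤-Reasoning
  y∉X = proj₁ (∈∁∪⁅⁆⁻ y∈outside)
  y≢s = proj₂ (∈∁∪⁅⁆⁻ y∈outside)

maximal⇒∈ : ∀ {G : Graph n} {s k I e} → MaximalIndependent G s k I → AtS G s e →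
  (∀ {f} → f ∈ I → ¬ LAdj G s k e f × ¬ LAdj G s k f e) → e ∈ I
maximal⇒∈ {G = G} {s} {k} {I} {e} (independent , maximal) ate nonadjacent =
  maximal (I ∪ ⁅ e ⁆) (atS , nonadjacent′) (p⊆p∪q ⁅ e ⁆) (x∈p∪q⁺ (inj₂ (x∈⁅x⁆ e)))
  where
  cases : ∀ {f} → f ∈ I ∪ ⁅ e ⁆ → f ∈ I ⊎ f ≡ e
  cases f∈ = Sum.map₂ (x∈⁅y⁆⇒x≡y e) (x∈p∪q⁻ I ⁅ e ⁆ f∈)
  atS : ∀ f → f ∈ I ∪ ⁅ e ⁆ → AtS G s f
  atS f f∈ with cases f∈
  ... | inj₁ f∈I = proj₁ independent f f∈I
  ... | inj₂ refl = ate
  nonadjacent′ : ∀ f g → f ∈ I ∪ ⁅ e ⁆ → g ∈ I ∪ ⁅ e ⁆ → ¬ LAdj G s k f g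
  nonadjacent′ f g f∈ g∈ with cases f∈ | cases g∈
  ... | inj₁ f∈I | inj₁ g∈I = proj₂ independent f g f∈I g∈I
  ... | inj₁ f∈I | inj₂ refl = proj₂ (nonadjacent f∈I)
  ... | inj₂ refl | inj₁ g∈I = proj₁ (nonadjacent g∈I)
  ... | inj₂ refl | inj₂ refl = λ adjacent → proj₁ adjacent refl

-- Maximal independent sets and their dangerous sets

module _ {n} {G : Graph n} {s : Fin n} {k : ℕ} (connected : SKConnected G s k) where

  private
    end : Edge G → Fin n
    end = otherEnd G s

  record Corresponding (I : Subset (length G)) (A : Subset n) : Set where
    field
      maximal : MaximalIndependent G s k I
      minimal : CorrespondingDangerous G s k I A
      two≤∣I∣ : 2 ≤ ∣ I ∣

    dangerous : Dangerous G s k A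
    dangerous = proj₁ minimal

    s∉A : s ∉ A
    s∉A = proj₁ dangerous

    cut≤ : cutSize G A ≤ suc k
    cut≤ = proj₂ (proj₂ (proj₂ dangerous))

    atS : ∀ {e} → e ∈ I → AtS G s e
    atS = proj₁ (proj₁ maximal) _

    end∈ : ∀ {e} → e ∈ I → end e ∈ A
    end∈ = proj₁ (proj₂ minimal) _

  open Corresponding

  ∈⇒≢s : ∀ {I A x} → Corresponding I A → x ∈ A → x ≢ s
  ∈⇒≢s c x∈A = ∈-∉⇒≢ x∈A (s∉A c)

  k≤cut : ∀ {X u v} → u ∈ X → v ∉ X → u ≢ s → v ≢ s → k ≤ cutSize G X
  k≤cut = k≤cutSize connected

  covered⇒∈ : ∀ {I A Y Z e} → Corresponding I A → Dangerous G s k Y → Dangerous G s k Z →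
    AtS G s e → end e ∈ Y → end e ∈ Z → (∀ {f} → f ∈ I → end f ∈ Y ⊎ end f ∈ Z) → e ∈ I
  covered⇒∈ {e = e} c dY dZ ate e∈Y e∈Z covered = maximal⇒∈ {G = G} (maximal c) ate λ {f} f∈I →
    [ nonadjacent {e = e} {f} dY e∈Y , nonadjacent {e = e} {f} dZ e∈Z ]′ (covered f∈I)
    where
    nonadjacent : ∀ {X e f} → Dangerous G s k X → end e ∈ X → end f ∈ X → ¬ LAdj G s k e f × ¬ LAdj G s k f e
    nonadjacent dX e∈X f∈X = dangerous⇒¬LAdj {G = G} dX e∈X f∈X , dangerous⇒¬LAdj {G = G} dX f∈X e∈X

  end∈⇒∈ : ∀ {I A e} → Corresponding I A → AtS G s e → end e ∈ A → e ∈ I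
  end∈⇒∈ c ate e∈A = covered⇒∈ c (dangerous c) (dangerous c) ate e∈A e∈A (inj₁ ∘ end∈ c)

  ⊆⇒≡ : ∀ {I A J B} → Corresponding I A → Corresponding J B → A ⊆ B → I ≡ J
  ⊆⇒≡ {I = I} {J = J} cI cJ A⊆B = ⊆-antisym I⊆J (proj₂ (maximal cI) J (proj₁ (maximal cJ)) I⊆J)
    where
    I⊆J : I ⊆ J
    I⊆J e∈I = end∈⇒∈ cJ (atS cI e∈I) (A⊆B (end∈ cI e∈I))

  ≢⇒⊈ : ∀ {I A J B} → Corresponding I A → Corresponding J B → I ≢ J → Nonempty (A ─ B)
  ≢⇒⊈ {A = A} {B = B} cI cJ I≢J with nonempty? (A ─ B)
  ... | yes A─B≠∅ = A─B≠∅
  ... | no A─B=∅ = ⊥-elim (I≢J (⊆⇒≡ cI cJ A⊆B))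
    where
    A⊆B : A ⊆ B
    A⊆B {x} x∈A with x ∈? B
    ... | yes x∈B = x∈B
    ... | no x∉B = ⊥-elim (A─B=∅ (x , x∈p∧x∉q⇒x∈p─q x∈A x∉B))

  least : ∀ {I A Y} → Corresponding I A → Y ⊆ A → cutSize G Y ≤ suc k → (∀ {e} → e ∈ I → end e ∈ Y) → A ⊆ Y
  least {Y = Y} c Y⊆A cutY≤ ends∈Y {x} x∈A with x ∈? Y
  ... | yes x∈Y = x∈Y
  ... | no x∉Y = proj₂ (proj₂ (minimal c)) Y dangerousY (λ _ → ends∈Y) Y⊆A x∈A
    where
    e₀∈I = proj₂ (1≤∣p∣⇒nonempty (≤-trans (s≤s z≤n) (two≤∣I∣ c)))
    dangerousY : Dangerous G s k Y
    dangerousY = s∉A c ∘ Y⊆A , (_ , ends∈Y e₀∈I) , (x , ∈∁∪⁅⁆⁺ x∉Y (∈⇒≢s c x∈A)) , cutY≤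

  -- Otherwise A ─ B would be a dangerous set strictly below A containing the ends of I.
  cutSize-─-large : ∀ {I A B x} → Corresponding I A → x ∈ A → x ∈ B → ¬ (∃[ e ] e ∈ I × end e ∈ B) →
    suc k < cutSize G (A ─ B)
  cutSize-─-large {I} {A} {B} c x∈A x∈B I↛B = ≰⇒> λ cut≤′ → x∈q⇒x∉p─q A B x∈B (least c (p─q⊆p A B) cut≤′ ends∈ x∈A)
    where
    ends∈ : ∀ {e} → e ∈ I → end e ∈ A ─ B
    ends∈ e∈I = x∈p∧x∉q⇒x∈p─q (end∈ c e∈I) λ e∈B → I↛B (_ , e∈I , e∈B)

  commonEdge : ∀ {I A J B} → Corresponding I A → Corresponding J B → Nonempty (A ∩ B) →
    ∃[ e ] AtS G s e × end e ∈ A ∩ B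
  commonEdge {I} {A} {J} {B} cI cJ (x , x∈A∩B)
    with any? (λ e → e ∈? I ×-dec end e ∈? B) | any? (λ e → e ∈? J ×-dec end e ∈? A)
  ... | yes (e , e∈I , e∈B) | _ = e , atS cI e∈I , x∈p∩q⁺ (end∈ cI e∈I , e∈B)
  ... | no _ | yes (e , e∈J , e∈A) = e , atS cJ e∈J , x∈p∩q⁺ (e∈A , end∈ cJ e∈J)
  ... | no I↛B | no J↛A = ⊥-elim (<⇒≱ (+-mono-< (cutSize-─-large cI x∈A x∈B I↛B) (cutSize-─-large cJ x∈B x∈A J↛A)) (begin
    cutSize G (A ─ B) + cutSize G (B ─ A)                                    ≤⟨ m≤m+n _ _ ⟩
    cutSize G (A ─ B) + cutSize G (B ─ A) + 2 * sum (map (𝟙 ∘ jumps₂ A B) G) ≤⟨ cutSize-─-─ G A B ⟩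
    cutSize G A + cutSize G B                                                ≤⟨ +-mono-≤ (cut≤ cI) (cut≤ cJ) ⟩
    suc k + suc k                                                            ∎))
    where
    open ≤-Reasoning
    x∈A = proj₁ (x∈p∩q⁻ A B x∈A∩B)
    x∈B = proj₂ (x∈p∩q⁻ A B x∈A∩B)

  ¬twoEdgesInto∩ : ∀ {I A J B e f} → Corresponding I A → Corresponding J B → I ≢ J →
    AtS G s e → AtS G s f → e ≢ f → end e ∈ A ∩ B → end f ∉ A ∩ B
  ¬twoEdgesInto∩ {A = A} {B = B} {e} {f} cI cJ I≢J ate atf e≢f e∈A∩B f∈A∩B = 2k+4≰2k+2 k (begin
    k + k + 2 * 2
      ≤⟨ +-mono-≤ (+-mono-≤ k≤cut₁ k≤cut₂) (*-monoʳ-≤ 2 two≤jumps) ⟩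
    cutSize G (A ─ B) + cutSize G (B ─ A) + 2 * sum (map J G)
      ≤⟨ cutSize-─-─ G A B ⟩
    cutSize G A + cutSize G B
      ≤⟨ +-mono-≤ (cut≤ cI) (cut≤ cJ) ⟩
    suc k + suc k ∎)
    where
    open ≤-Reasoning
    J = 𝟙 ∘ jumps₂ A B
    e≢s = ∈⇒≢s cI (p∩q⊆p A B e∈A∩B)
    k≤cut₁ : k ≤ cutSize G (A ─ B)
    k≤cut₁ with ≢⇒⊈ cI cJ I≢J
    ... | x , x∈A─B = k≤cut x∈A─B (x∈q⇒x∉p─q A B (p∩q⊆q A B e∈A∩B)) (∈⇒≢s cI (p─q⊆p A B x∈A─B)) e≢s
    k≤cut₂ : k ≤ cutSize G (B ─ A)
    k≤cut₂ with ≢⇒⊈ cJ cI (I≢J ∘ sym)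
    ... | x , x∈B─A = k≤cut x∈B─A (x∈q⇒x∉p─q B A (p∩q⊆p A B e∈A∩B)) (∈⇒≢s cJ (p─q⊆p B A x∈B─A)) e≢s
    two≤jumps : 2 ≤ sum (map J G)
    two≤jumps = subst (_≤ sum (map J G))
      (cong₂ (λ a b → 𝟙 a + 𝟙 b) (atS-jumps₂ {G = G} ate (s∉A cI) (s∉A cJ) e∈A∩B) (atS-jumps₂ {G = G} atf (s∉A cI) (s∉A cJ) f∈A∩B))
      (ends+ends≤sum G J e≢f)

  privateVertex : ∀ {Ix Ax Iy Ay Iz Az e} → Corresponding Ix Ax → Corresponding Iy Ay → Corresponding Iz Az →
    Ix ≢ Iy → Ix ≢ Iz → AtS G s e → end e ∈ Ay ∩ Az → Nonempty (Ax ─ Ay ─ Az)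
  privateVertex {Ix} {Ax} {Iy} {Ay} {Iz} {Az} {e} cx cy cz x≢y x≢z ate e∈Ay∩Az with nonempty? (Ax ─ Ay ─ Az)
  ... | yes private′ = private′
  ... | no none = ⊥-elim ([ ¬both cy x≢y e∈Ay , ¬both cz x≢z e∈Az ]′ (covered f∈Ix))
    where
    e∈Ay = proj₁ (x∈p∩q⁻ Ay Az e∈Ay∩Az)
    e∈Az = proj₂ (x∈p∩q⁻ Ay Az e∈Ay∩Az)
    covered : ∀ {f} → f ∈ Ix → end f ∈ Ay ⊎ end f ∈ Az
    covered {f} f∈Ix with end f ∈? Ay | end f ∈? Az
    ... | yes f∈Ay | _ = inj₁ f∈Ay
    ... | no _ | yes f∈Az = inj₂ f∈Az
    ... | no f∉Ay | no f∉Az = ⊥-elim (none (end f , x∈p∧x∉q⇒x∈p─q (x∈p∧x∉q⇒x∈p─q (end∈ cx f∈Ix) f∉Ay) f∉Az))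
    e∈Ix = covered⇒∈ cx (dangerous cy) (dangerous cz) ate e∈Ay e∈Az covered
    another = 2≤∣p∣⇒another (two≤∣I∣ cx) e
    f = proj₁ another
    f∈Ix = proj₁ (proj₂ another)
    ¬both : ∀ {Iw Aw} → Corresponding Iw Aw → Ix ≢ Iw → end e ∈ Aw → end f ∉ Aw
    ¬both cw x≢w e∈Aw f∈Aw = ¬twoEdgesInto∩ cx cw x≢w ate (atS cx f∈Ix) (proj₂ (proj₂ another) ∘ sym)
      (x∈p∩q⁺ (end∈ cx e∈Ix , e∈Aw)) (x∈p∩q⁺ (end∈ cx f∈Ix , f∈Aw))

  noTripleIntersection : ∀ {I₁ A₁ I₂ A₂ I₃ A₃} →
    Corresponding I₁ A₁ → Corresponding I₂ A₂ → Corresponding I₃ A₃ → I₁ ≢ I₂ → I₁ ≢ I₃ → I₂ ≢ I₃ → 2 ≤ k →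
    ∀ {x} → ¬ (x ∈ A₁ × x ∈ A₂ × x ∈ A₃)
  noTripleIntersection {A₁ = A₁} {A₂ = A₂} {A₃ = A₃} c₁ c₂ c₃ I₁≢I₂ I₁≢I₃ I₂≢I₃ 2≤k {x} (x∈A₁ , x∈A₂ , x∈A₃) =
    4k+2≰3k+3 k 2≤k (begin
      k + k + k + k + 2 * 1
        ≤⟨ +-mono-≤ (+-mono-≤ (+-mono-≤ (+-mono-≤ k≤cut₁ k≤cut₂) k≤cut₃) k≤cut∩) (*-monoʳ-≤ 2 one≤jumps) ⟩
      cutSize G (A₁ ─ A₂ ─ A₃) + cutSize G (A₂ ─ A₁ ─ A₃) + cutSize G (A₃ ─ A₁ ─ A₂) +
      cutSize G (A₁ ∩ A₂ ∩ A₃) + 2 * sum (map J G)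
        ≤⟨ cutSize-─-─-─-∩ G A₁ A₂ A₃ ⟩
      cutSize G A₁ + cutSize G A₂ + cutSize G A₃
        ≤⟨ +-mono-≤ (+-mono-≤ (cut≤ c₁) (cut≤ c₂)) (cut≤ c₃) ⟩
      suc k + suc k + suc k ∎)
    where
    open ≤-Reasoning
    J = 𝟙 ∘ jumps₃ A₁ A₂ A₃
    e₁₂ = commonEdge c₁ c₂ (x , x∈p∩q⁺ (x∈A₁ , x∈A₂))
    e₁₃ = commonEdge c₁ c₃ (x , x∈p∩q⁺ (x∈A₁ , x∈A₃))
    e₂₃ = commonEdge c₂ c₃ (x , x∈p∩q⁺ (x∈A₂ , x∈A₃))
    v₁ = privateVertex c₁ c₂ c₃ I₁≢I₂ I₁≢I₃ (proj₁ (proj₂ e₂₃)) (proj₂ (proj₂ e₂₃))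
    v₂ = privateVertex c₂ c₁ c₃ (I₁≢I₂ ∘ sym) I₂≢I₃ (proj₁ (proj₂ e₁₃)) (proj₂ (proj₂ e₁₃))
    v₃ = privateVertex c₃ c₁ c₂ (I₁≢I₃ ∘ sym) (I₂≢I₃ ∘ sym) (proj₁ (proj₂ e₁₂)) (proj₂ (proj₂ e₁₂))
    x≢s = ∈⇒≢s c₁ x∈A₁
    k≤cut₁ : k ≤ cutSize G (A₁ ─ A₂ ─ A₃)
    k≤cut₁ = k≤cut (proj₂ v₁) (x∈q⇒x∉p─q─r A₁ A₂ A₃ x∈A₂) (∈⇒≢s c₁ (p─q─r⊆p A₁ A₂ A₃ (proj₂ v₁))) x≢s
    k≤cut₂ : k ≤ cutSize G (A₂ ─ A₁ ─ A₃)
    k≤cut₂ = k≤cut (proj₂ v₂) (x∈q⇒x∉p─q─r A₂ A₁ A₃ x∈A₁) (∈⇒≢s c₂ (p─q─r⊆p A₂ A₁ A₃ (proj₂ v₂))) x≢s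
    k≤cut₃ : k ≤ cutSize G (A₃ ─ A₁ ─ A₂)
    k≤cut₃ = k≤cut (proj₂ v₃) (x∈q⇒x∉p─q─r A₃ A₁ A₂ x∈A₁) (∈⇒≢s c₃ (p─q─r⊆p A₃ A₁ A₂ (proj₂ v₃))) x≢s
    k≤cut∩ : k ≤ cutSize G (A₁ ∩ A₂ ∩ A₃)
    k≤cut∩ = k≤cut (x∈p∩q⁺ (x∈A₁ , x∈p∩q⁺ (x∈A₂ , x∈A₃))) (x∈p─q─r⇒x∉p∩q∩r A₁ A₂ A₃ (proj₂ v₁))
      x≢s (∈⇒≢s c₁ (p─q─r⊆p A₁ A₂ A₃ (proj₂ v₁)))
    one≤jumps : 1 ≤ sum (map J G)
    one≤jumps = subst (_≤ sum (map J G))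
      (cong 𝟙 (atS-jumps₃ {G = G} (proj₁ (proj₂ e₁₂)) (s∉A c₁) (s∉A c₂) (s∉A c₃) (proj₂ (proj₂ e₁₂))))
      (ends≤sum G J (proj₁ e₁₂))

lemma4p6 : ∀ {n} (G : Graph n) (s : Fin n) (k : ℕ) →
    Loopless G → SKConnected G s k → 2 ≤ k → 4 ≤ deg G s →
    (I₁ I₂ I₃ : Subset (length G)) →
    MaximalIndependent G s k I₁ → MaximalIndependent G s k I₂ → MaximalIndependent G s k I₃ →
    I₁ ≢ I₂ → I₁ ≢ I₃ → I₂ ≢ I₃ →
    2 ≤ ∣ I₁ ∣ → 2 ≤ ∣ I₂ ∣ → 2 ≤ ∣ I₃ ∣ →
    (A₁ A₂ A₃ : Subset n) →
    CorrespondingDangerous G s k I₁ A₁ → CorrespondingDangerous G s k I₂ A₂ →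
    CorrespondingDangerous G s k I₃ A₃ →
    (A₁ ∩ A₂ ∩ A₃ ≡ ⊥) ×
    (Nonempty (I₁ ∩ I₂) → Nonempty (I₂ ∩ I₃) → Nonempty (I₁ ∩ I₃) →
      (A₁ ∩ (A₂ ∪ A₃) ≡ (A₁ ∩ (A₂ ─ A₃)) ∪ (A₁ ∩ (A₃ ─ A₂))) ×
      (A₂ ∩ (A₁ ∪ A₃) ≡ (A₂ ∩ (A₁ ─ A₃)) ∪ (A₂ ∩ (A₃ ─ A₁))) ×
      (A₃ ∩ (A₁ ∪ A₂) ≡ (A₃ ∩ (A₁ ─ A₂)) ∪ (A₃ ∩ (A₂ ─ A₁))))
lemma4p6 G s k _ connected 2≤k _ I₁ I₂ I₃ max₁ max₂ max₃ I₁≢I₂ I₁≢I₃ I₂≢I₃ 2≤∣I₁∣ 2≤∣I₂∣ 2≤∣I₃∣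
         A₁ A₂ A₃ min₁ min₂ min₃ =
  Empty-unique (λ (x , x∈A₁∩A₂∩A₃) → noTriple (∈∩∩ x∈A₁∩A₂∩A₃)) ,
  λ _ _ _ → ∩-∪≡∩─∪∩─ A₁ A₂ A₃ noTriple ,
            ∩-∪≡∩─∪∩─ A₂ A₁ A₃ (λ (x∈A₂ , x∈A₁ , x∈A₃) → noTriple (x∈A₁ , x∈A₂ , x∈A₃)) ,
            ∩-∪≡∩─∪∩─ A₃ A₁ A₂ (λ (x∈A₃ , x∈A₁ , x∈A₂) → noTriple (x∈A₁ , x∈A₂ , x∈A₃))
  where
  noTriple : ∀ {x} → ¬ (x ∈ A₁ × x ∈ A₂ × x ∈ A₃)
  noTriple = noTripleIntersection connected
    (record { maximal = max₁ ; minimal = min₁ ; two≤∣I∣ = 2≤∣I₁∣ })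
    (record { maximal = max₂ ; minimal = min₂ ; two≤∣I∣ = 2≤∣I₂∣ })
    (record { maximal = max₃ ; minimal = min₃ ; two≤∣I∣ = 2≤∣I₃∣ })
    I₁≢I₂ I₁≢I₃ I₂≢I₃ 2≤k
  ∈∩∩ : ∀ {x} → x ∈ A₁ ∩ A₂ ∩ A₃ → x ∈ A₁ × x ∈ A₂ × x ∈ A₃
  ∈∩∩ x∈ = proj₁ (x∈p∩q⁻ A₁ _ x∈) , x∈p∩q⁻ A₂ A₃ (proj₂ (x∈p∩q⁻ A₁ _ x∈))
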